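{- Let $p$ be an odd prime with $p\neq 3$ and let $k\geq 1$ be an integer. Then $2p^k$ lies in the image of $\phi$ if and only if $2p^k+1$ is a prime number, $2p^k+1\equiv 3 \pmod 4$, and $k$ is odd.
   Context: $\phi$ denotes Euler's totient function: for a positive integer $n$, $\phi(n)$ is the number of integers $x$ with $1\le x\le n$ and $\gcd(x,n)=1$. The image of $\phi$ is the set $\{\phi(n) : n \text{ a positive integer}\}$. -}

module Defs where

open import Data.Nat using (ℕ; suc; _+_)
open import Data.Nat.GCD using (gcd)
open import Data.Nat.Properties using (_≟_)
open import Data.List using (List; length; filter; upTo; map)
open import Data.Product using (∃-syntax)
open import Relation.Binary.PropositionalEquality using (_≡_)

-- Euler's totient: number of x with 1 ≤ x ≤ n and gcd(x,n) = 1.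
-- The candidates 1..n are listed as map suc (upTo n) = [1, …, n].
φ : ℕ → ℕ
φ n = length (filter (λ x → gcd x n ≟ 1) (map suc (upTo n)))

InImageφ : ℕ → Set
InImageφ m = ∃[ n ] (φ (suc n) ≡ m)

module Submission where

-- The heart of the proof is a statement about values of φ of the form 2y
-- with y odd, y ≠ 1 (twice-odd-value): if φ n = 2y, then either 2y + 1 is prime
-- or some prime q divides y with (q − 1) ∣ 2y.  It follows by strong
-- induction on n from the two product rules for φ,
--     φ (q·m) = q · φ m          if q ∣ m,
--     φ (q·m) = (q − 1) · φ m    if q is a prime not dividing m,
-- and from their consequences (q − 1) ∣ φ m for every prime q ∣ m, and
-- φ m even for m ≥ 3.  The product rules are proved by counting: φ m is the
-- number of residues x < m coprime to m, and coprimality to m is m-periodic.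
--
-- For y = pᵏ the second alternative would force q = p and (p − 1) ∣ 2, which
-- is impossible for p ≥ 5; so 2pᵏ + 1 is prime.  The congruence mod 4 holds
-- because pᵏ is odd, and k must be odd since for even k we have
-- pᵏ ≡ 1 (mod 3), making 3 a proper divisor of 2pᵏ + 1.  Conversely, if
-- N + 1 is prime then φ (N + 1) = N.

open import Defs
open import Data.Nat using (ℕ; zero; suc; _+_; _*_; _∸_; _^_; _≤_; _<_; _%_; z≤n; s≤s; nonTrivial⇒n>1)
open import Data.Nat.Properties
open import Data.Nat.Divisibility
open import Data.Nat.DivMod using (_/_; m≡m%n+[m/n]*n; m%n<n; [m+kn]%n≡m%n; %-distribˡ-+; %-distribˡ-*)
open import Data.Nat.GCD using (gcd)
open import Data.Nat.Coprimality using (Coprime; coprime⇒gcd≡1; gcd≡1⇒coprime; coprime-divisor) renaming (sym to coprime-sym)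
open import Data.Nat.Primality using (Prime; prime; prime[2]; ¬prime[1]; euclidsLemma; prime⇒irreducible)
open import Data.Nat.Primality.Factorisation using (factorise; PrimeFactorisation)
open import Data.Nat.ListAction using (product)
open import Data.Nat.Induction using (<-rec)
open import Data.Nat.Tactic.RingSolver using (solve-∀)
open import Data.List using (List; _∷_; length; filter; applyUpTo)
open import Data.List.Properties using (map-applyUpTo)
open import Data.List.Relation.Unary.All using (All; _∷_)
open import Data.Product using (_×_; _,_; ∃-syntax)
open import Data.Sum using (_⊎_; inj₁; inj₂)
open import Function using (_∘_)
open import Function.Bundles using (_⇔_; mk⇔)
open import Relation.Nullary using (¬_; Dec; yes; no; contradiction)
open import Relation.Binary.PropositionalEquality

∑< : ℕ → (ℕ → ℕ) → ℕ
∑< zero    f = 0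
∑< (suc n) f = f 0 + ∑< n (λ x → f (suc x))

𝟙 : ∀ {A : Set} → Dec A → ℕ
𝟙 (yes _) = 1
𝟙 (no _)  = 0

𝟙-yes : ∀ {A : Set} (d : Dec A) → A → 𝟙 d ≡ 1
𝟙-yes (yes _) _ = refl
𝟙-yes (no ¬a) a = contradiction a ¬a

𝟙-no : ∀ {A : Set} (d : Dec A) → ¬ A → 𝟙 d ≡ 0
𝟙-no (yes a) ¬a = contradiction a ¬a
𝟙-no (no _)  _  = refl

count-filter : ∀ {P : ℕ → Set} (P? : ∀ x → Dec (P x)) n (g : ℕ → ℕ) →
  length (filter P? (applyUpTo g n)) ≡ ∑< n (λ x → 𝟙 (P? (g x)))
count-filter P? zero    g = refl
count-filter P? (suc n) g with P? (g 0)
... | yes _ = cong suc (count-filter P? n (g ∘ suc))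
... | no _  = count-filter P? n (g ∘ suc)

∑<-cong : ∀ n {f g : ℕ → ℕ} → (∀ x → x < n → f x ≡ g x) → ∑< n f ≡ ∑< n g
∑<-cong zero    eq = refl
∑<-cong (suc n) eq =
  cong₂ _+_ (eq 0 (s≤s z≤n)) (∑<-cong n (λ x x<n → eq (suc x) (s≤s x<n)))

∑<-const : ∀ n c → ∑< n (λ _ → c) ≡ n * c
∑<-const zero    c = refl
∑<-const (suc n) c = cong (c +_) (∑<-const n c)

+-interchange : ∀ a b c d → (a + b) + (c + d) ≡ (a + c) + (b + d)
+-interchange = solve-∀

∑<-+ : ∀ n (f g : ℕ → ℕ) → ∑< n (λ x → f x + g x) ≡ ∑< n f + ∑< n g
∑<-+ zero    f g = refl
∑<-+ (suc n) f g = trans (cong (f 0 + g 0 +_) (∑<-+ n (f ∘ suc) (g ∘ suc)))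
                         (+-interchange (f 0) (g 0) _ _)

∑<-split : ∀ a b (f : ℕ → ℕ) → ∑< (a + b) f ≡ ∑< a f + ∑< b (λ x → f (a + x))
∑<-split zero    b f = refl
∑<-split (suc a) b f =
  trans (cong (f 0 +_) (∑<-split a b (f ∘ suc))) (sym (+-assoc (f 0) _ _))

∑<-blocks : ∀ a b (f : ℕ → ℕ) →
  ∑< (a * b) f ≡ ∑< a (λ y → ∑< b (λ i → f (y * b + i)))
∑<-blocks zero    b f = refl
∑<-blocks (suc a) b f = begin
  ∑< (b + a * b) f
    ≡⟨ ∑<-split b (a * b) f ⟩
  ∑< b f + ∑< (a * b) (λ x → f (b + x))
    ≡⟨ cong (∑< b f +_) (∑<-blocks a b (λ x → f (b + x))) ⟩
  ∑< b f + ∑< a (λ y → ∑< b (λ i → f (b + (y * b + i))))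
    ≡⟨ cong (∑< b f +_) (∑<-cong a (λ y _ →
         ∑<-cong b (λ i _ → cong f (sym (+-assoc b (y * b) i))))) ⟩
  ∑< b f + ∑< a (λ y → ∑< b (λ i → f (b + y * b + i))) ∎
  where open ≡-Reasoning

∑<-periodic : ∀ q m (f : ℕ → ℕ) → (∀ x → f (m + x) ≡ f x) →
  ∑< (q * m) f ≡ q * ∑< m f
∑<-periodic q m f periodic = begin
  ∑< (q * m) f                                ≡⟨ ∑<-blocks q m f ⟩
  ∑< q (λ y → ∑< m (λ i → f (y * m + i)))     ≡⟨ ∑<-cong q (λ y _ →
                                                   ∑<-cong m (λ i _ → shift y i)) ⟩
  ∑< q (λ _ → ∑< m f)                         ≡⟨ ∑<-const q (∑< m f) ⟩
  q * ∑< m f                                  ∎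
  where
  open ≡-Reasoning
  shift : ∀ y i → f (y * m + i) ≡ f i
  shift zero    i = refl
  shift (suc y) i = trans (cong f (+-assoc m (y * m) i))
                          (trans (periodic (y * m + i)) (shift y i))

∑<-rotate : ∀ n (f : ℕ → ℕ) → ∑< n (f ∘ suc) + f 0 ≡ ∑< n f + f n
∑<-rotate zero    f = refl
∑<-rotate (suc n) f = begin
  (f 1 + ∑< n (f ∘ suc ∘ suc)) + f 0   ≡⟨ cong (_+ f 0) (+-comm (f 1) _) ⟩
  (∑< n (f ∘ suc ∘ suc) + f 1) + f 0   ≡⟨ +-comm _ (f 0) ⟩
  f 0 + (∑< n (f ∘ suc ∘ suc) + f 1)   ≡⟨ cong (f 0 +_) (∑<-rotate n (f ∘ suc)) ⟩
  f 0 + (∑< n (f ∘ suc) + f (suc n))   ≡⟨ sym (+-assoc (f 0) _ _) ⟩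
  (f 0 + ∑< n (f ∘ suc)) + f (suc n)   ∎
  where open ≡-Reasoning

-- In each block of length q only the first index is a multiple of q, so
-- weighting by [q ∣ x] picks out the values at the multiples of q.
∑<-multiples : ∀ q′ m (g : ℕ → ℕ) →
  ∑< (m * suc q′) (λ x → 𝟙 (suc q′ ∣? x) * g x) ≡ ∑< m (λ y → g (y * suc q′))
∑<-multiples q′ m g =
  trans (∑<-blocks m q w) (∑<-cong m (λ y _ → block y))
  where
  q : ℕ
  q = suc q′
  w : ℕ → ℕ
  w x = 𝟙 (q ∣? x) * g x
  start : ∀ y → w (y * q + 0) ≡ g (y * q)
  start y = begin
    w (y * q + 0)                ≡⟨ cong w (+-identityʳ (y * q)) ⟩
    𝟙 (q ∣? y * q) * g (y * q)   ≡⟨ cong (_* g (y * q)) (𝟙-yes (q ∣? y * q) (n∣m*n y)) ⟩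
    g (y * q) + 0                ≡⟨ +-identityʳ _ ⟩
    g (y * q)                    ∎
    where open ≡-Reasoning
  rest : ∀ y i → i < q′ → w (y * q + suc i) ≡ 0
  rest y i i<q′ = cong (_* g (y * q + suc i)) (𝟙-no (q ∣? _) q∤)
    where
    q∤ : ¬ q ∣ y * q + suc i
    q∤ q∣ = <⇒≱ (s≤s i<q′) (∣⇒≤ (∣m+n∣m⇒∣n q∣ (n∣m*n y)))
  block : ∀ y → ∑< q (λ i → w (y * q + i)) ≡ g (y * q)
  block y = begin
    w (y * q + 0) + ∑< q′ (λ i → w (y * q + suc i))
      ≡⟨ cong₂ _+_ (start y) (∑<-cong q′ (rest y)) ⟩
    g (y * q) + ∑< q′ (λ _ → 0)
      ≡⟨ cong (g (y * q) +_) (trans (∑<-const q′ 0) (*-zeroʳ q′)) ⟩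
    g (y * q) + 0
      ≡⟨ +-identityʳ _ ⟩
    g (y * q) ∎
    where open ≡-Reasoning

coprime-* : ∀ {x a b} → Coprime x a → Coprime x b → Coprime x (a * b)
coprime-* {x} {a} {b} x⊥a x⊥b {d} (d∣x , d∣ab) = x⊥b (d∣x , coprime-divisor d⊥a d∣ab)
  where
  d⊥a : Coprime d a
  d⊥a (e∣d , e∣a) = x⊥a (∣-trans e∣d d∣x , e∣a)

coprime-*⇒coprimeʳ : ∀ {x} a {b} → Coprime x (a * b) → Coprime x b
coprime-*⇒coprimeʳ a x⊥ab (d∣x , d∣b) = x⊥ab (d∣x , ∣n⇒∣m*n a d∣b)

prime⇒2≤ : ∀ {q} → Prime q → 2 ≤ q
prime⇒2≤ {q} (prime _) = nonTrivial⇒n>1 q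

prime≢1 : ∀ {q} → Prime q → q ≢ 1
prime≢1 pq refl = ¬prime[1] pq

coprime-prime : ∀ {q x} → Prime q → ¬ q ∣ x → Coprime x q
coprime-prime pq q∤x {d} (d∣x , d∣q) with prime⇒irreducible pq d∣q
... | inj₁ d≡1    = d≡1
... | inj₂ refl   = contradiction d∣x q∤x

coprime-consecutive : ∀ n → Coprime n (suc n)
coprime-consecutive n {d} (d∣n , d∣1+n) =
  ∣1⇒≡1 (∣m+n∣m⇒∣n (subst (d ∣_) (+-comm 1 n) d∣1+n) d∣n)

χ : ℕ → ℕ → ℕ
χ m x = 𝟙 (gcd x m ≟ 1)

χ-coprime : ∀ {m x} → Coprime x m → χ m x ≡ 1
χ-coprime {m} {x} x⊥m = 𝟙-yes (gcd x m ≟ 1) (coprime⇒gcd≡1 x⊥m)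

χ-not-coprime : ∀ {m x} → ¬ Coprime x m → χ m x ≡ 0
χ-not-coprime {m} {x} x⊥̸m = 𝟙-no (gcd x m ≟ 1) (x⊥̸m ∘ gcd≡1⇒coprime)

χ-cong : ∀ {a x b y} → (Coprime x a → Coprime y b) → (Coprime y b → Coprime x a) →
  χ a x ≡ χ b y
χ-cong {a} {x} f g with gcd x a ≟ 1
... | yes x⊥a = sym (χ-coprime (f (gcd≡1⇒coprime x⊥a)))
... | no  x⊥̸a = sym (χ-not-coprime (x⊥̸a ∘ coprime⇒gcd≡1 ∘ g))

χ-periodic : ∀ m x → χ m (m + x) ≡ χ m x
χ-periodic m x = χ-cong {m} {m + x} {m} {x}
  (λ c (d∣x , d∣m) → c (∣m∣n⇒∣m+n d∣m d∣x , d∣m))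
  (λ c (d∣m+x , d∣m) → c (∣m+n∣m⇒∣n d∣m+x d∣m , d∣m))

-- Residue form of φ: φ m = #{x < m ∣ gcd x m = 1}; the candidate m of
-- Defs.φ is traded for the candidate 0, which is equivalent by periodicity.
φ-residues : ∀ m → φ m ≡ ∑< m (χ m)
φ-residues m = +-cancelʳ-≡ _ _ _ (begin
  φ m + χ m 0                 ≡⟨ cong (_+ χ m 0) shifted ⟩
  ∑< m (χ m ∘ suc) + χ m 0    ≡⟨ ∑<-rotate m (χ m) ⟩
  ∑< m (χ m) + χ m m          ≡⟨ cong (∑< m (χ m) +_) last≡first ⟩
  ∑< m (χ m) + χ m 0          ∎)
  where
  open ≡-Reasoning
  shifted : φ m ≡ ∑< m (χ m ∘ suc)
  shifted = trans (cong (length ∘ filter (λ x → gcd x m ≟ 1)) (map-applyUpTo (λ x → x) suc m))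
                  (count-filter (λ x → gcd x m ≟ 1) m suc)
  last≡first : χ m m ≡ χ m 0
  last≡first = trans (cong (χ m) (sym (+-identityʳ m))) (χ-periodic m 0)

-- φ (q·m) = q · φ m when q ∣ m: both sides count the residues below q·m
-- coprime to m, as q·m and m have the same prime divisors.
φ-*-divisor : ∀ q m → q ∣ m → φ (q * m) ≡ q * φ m
φ-*-divisor q m q∣m = begin
  φ (q * m)                ≡⟨ φ-residues (q * m) ⟩
  ∑< (q * m) (χ (q * m))   ≡⟨ ∑<-cong (q * m) (λ x _ →
                                χ-cong {q * m} {x} {m} {x} (coprime-*⇒coprimeʳ q) grow) ⟩
  ∑< (q * m) (χ m)         ≡⟨ ∑<-periodic q m (χ m) (χ-periodic m) ⟩
  q * ∑< m (χ m)           ≡⟨ cong (q *_) (sym (φ-residues m)) ⟩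
  q * φ m                  ∎
  where
  open ≡-Reasoning
  grow : ∀ {x} → Coprime x m → Coprime x (q * m)
  grow x⊥m = coprime-* (λ (d∣x , d∣q) → x⊥m (d∣x , ∣-trans d∣q q∣m)) x⊥m

χ-split : ∀ {q m} → Prime q → ¬ q ∣ m → ∀ x →
  χ m x ≡ χ (q * m) x + 𝟙 (q ∣? x) * χ m x
χ-split {q} {m} pq q∤m x with q ∣? x
... | yes q∣x = sym (cong₂ _+_ (χ-not-coprime shares-q) (*-identityˡ (χ m x)))
  where
  shares-q : ¬ Coprime x (q * m)
  shares-q x⊥qm = prime≢1 pq (x⊥qm (q∣x , m∣m*n m))
... | no q∤x = trans (χ-cong {m} {x} {q * m} {x} (coprime-* (coprime-prime pq q∤x))
                              (coprime-*⇒coprimeʳ q))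
                     (sym (+-identityʳ _))

-- For a prime q ∤ m: φ (q·m) + φ m = q · φ m.  The residues below q·m
-- coprime to m are those coprime to q·m together with the multiples y·q,
-- y < m, with y coprime to m.
φ-*-prime-sum : ∀ {q m} → Prime q → ¬ q ∣ m → φ (q * m) + φ m ≡ q * φ m
φ-*-prime-sum {suc q′} {m} pq q∤m = begin
  φ (q * m) + φ m
    ≡⟨ cong₂ _+_ (φ-residues (q * m)) (sym multiples) ⟩
  ∑< (q * m) (χ (q * m)) + ∑< (q * m) w
    ≡⟨ sym (∑<-+ (q * m) (χ (q * m)) w) ⟩
  ∑< (q * m) (λ x → χ (q * m) x + w x)
    ≡⟨ sym (∑<-cong (q * m) (λ x _ → χ-split pq q∤m x)) ⟩
  ∑< (q * m) (χ m)
    ≡⟨ ∑<-periodic q m (χ m) (χ-periodic m) ⟩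
  q * ∑< m (χ m)
    ≡⟨ cong (q *_) (sym (φ-residues m)) ⟩
  q * φ m ∎
  where
  open ≡-Reasoning
  q : ℕ
  q = suc q′
  w : ℕ → ℕ
  w x = 𝟙 (q ∣? x) * χ m x
  add-q : ∀ {y} → Coprime y m → Coprime (y * q) m
  add-q y⊥m = coprime-sym (coprime-* (coprime-sym y⊥m) (coprime-prime pq q∤m))
  drop-q : ∀ {y} → Coprime (y * q) m → Coprime y m
  drop-q yq⊥m (d∣y , d∣m) = yq⊥m (∣m⇒∣m*n q d∣y , d∣m)
  multiples : ∑< (q * m) w ≡ φ m
  multiples = begin
    ∑< (q * m) w                ≡⟨ cong (λ n → ∑< n w) (*-comm q m) ⟩
    ∑< (m * q) w                ≡⟨ ∑<-multiples q′ m (χ m) ⟩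
    ∑< m (λ y → χ m (y * q))    ≡⟨ ∑<-cong m (λ y _ → χ-cong {m} {y * q} {m} {y} drop-q add-q) ⟩
    ∑< m (χ m)                  ≡⟨ sym (φ-residues m) ⟩
    φ m                         ∎

φ-*-prime : ∀ {q m} → Prime q → ¬ q ∣ m → φ (q * m) ≡ (q ∸ 1) * φ m
φ-*-prime {q} {m} pq q∤m = begin
  φ (q * m)                  ≡⟨ sym (m+n∸n≡m (φ (q * m)) (φ m)) ⟩
  φ (q * m) + φ m ∸ φ m      ≡⟨ cong (_∸ φ m) (φ-*-prime-sum pq q∤m) ⟩
  q * φ m ∸ φ m              ≡⟨ cong (q * φ m ∸_) (sym (*-identityˡ (φ m))) ⟩
  q * φ m ∸ 1 * φ m          ≡⟨ sym (*-distribʳ-∸ (φ m) q 1) ⟩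
  (q ∸ 1) * φ m              ∎
  where open ≡-Reasoning

φ-prime : ∀ {q} → Prime q → φ q ≡ q ∸ 1
φ-prime {q} pq = begin
  φ q              ≡⟨ cong φ (sym (*-identityʳ q)) ⟩
  φ (q * 1)        ≡⟨ φ-*-prime pq (prime≢1 pq ∘ ∣1⇒≡1) ⟩
  (q ∸ 1) * 1      ≡⟨ *-identityʳ (q ∸ 1) ⟩
  q ∸ 1            ∎
  where open ≡-Reasoning

prime-divisor : ∀ n → 2 ≤ n → ∃[ q ] (Prime q × q ∣ n)
prime-divisor (suc zero) (s≤s ())
prime-divisor n@(suc (suc _)) _ =
  first (PrimeFactorisation.factors F) (PrimeFactorisation.isFactorisation F)
        (PrimeFactorisation.factorsPrime F)
  where
  F : PrimeFactorisation n
  F = factorise n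
  first : (qs : List ℕ) → n ≡ product qs → All Prime qs → ∃[ q ] (Prime q × q ∣ n)
  first (q ∷ qs) n≡ (pq ∷ _) = q , pq , divides (product qs) (trans n≡ (*-comm q _))

divisor-of-prime : ∀ {p d} → Prime p → d ∣ p → d ≢ 1 → d ≡ p
divisor-of-prime pp d∣p d≢1 with prime⇒irreducible pp d∣p
... | inj₁ d≡1 = contradiction d≡1 d≢1
... | inj₂ d≡p = d≡p

prime-∣-power : ∀ {q} a k → Prime q → q ∣ a ^ k → q ∣ a
prime-∣-power a zero    pq q∣1 = contradiction (∣1⇒≡1 q∣1) (prime≢1 pq)
prime-∣-power a (suc k) pq q∣aᵏ⁺¹ with euclidsLemma a (a ^ k) pq q∣aᵏ⁺¹
... | inj₁ q∣a  = q∣a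
... | inj₂ q∣aᵏ = prime-∣-power a k pq q∣aᵏ

parity : ∀ n → 2 ∣ n ⊎ ∃[ t ] (n ≡ 1 + t * 2)
parity zero = inj₁ (2 ∣0)
parity (suc n) with parity n
... | inj₁ (divides t n≡t*2) = inj₂ (t , cong suc n≡t*2)
... | inj₂ (t , n≡1+t*2)     = inj₁ (divides (suc t) (cong suc n≡1+t*2))

odd-prime-pred-even : ∀ {q} → Prime q → q ≢ 2 → 2 ∣ q ∸ 1
odd-prime-pred-even {q} pq q≢2 with parity q
... | inj₁ 2∣q       = contradiction (sym (divisor-of-prime pq 2∣q (λ ()))) q≢2
... | inj₂ (t , q≡)  = divides t (cong (_∸ 1) q≡)

odd-prime-∣-double : ∀ {q y} → Prime q → q ≢ 2 → q ∣ 2 * y → q ∣ y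
odd-prime-∣-double {y = y} pq q≢2 q∣2y with euclidsLemma 2 y pq q∣2y
... | inj₁ q∣2 = contradiction (divisor-of-prime prime[2] q∣2 (prime≢1 pq)) q≢2
... | inj₂ q∣y = q∣y

even-product : ∀ {a b y} → 2 ∣ a → 2 ∣ b → a * b ≡ 2 * y → 2 ∣ y
even-product {y = y} (divides s refl) (divides t refl) ab≡2y =
  divides (s * t) (*-cancelˡ-≡ y (s * t * 2) 2 (trans (sym ab≡2y) (regroup s t)))
  where
  regroup : ∀ s t → s * 2 * (t * 2) ≡ 2 * (s * t * 2)
  regroup = solve-∀

-- (q − 1) ∣ φ (q·a) for a prime q, by strong induction on a: when q ∤ a
-- this is the product rule, otherwise a = q·b with b < a.
pred∣φ-multiple : ∀ {q} → Prime q → ∀ a → (q ∸ 1) ∣ φ (q * a)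
pred∣φ-multiple {q} pq = <-rec (λ a → (q ∸ 1) ∣ φ (q * a)) step
  where
  step : ∀ a → (∀ {b} → b < a → (q ∸ 1) ∣ φ (q * b)) → (q ∸ 1) ∣ φ (q * a)
  step zero _ = subst (λ n → (q ∸ 1) ∣ φ n) (sym (*-zeroʳ q)) ((q ∸ 1) ∣0)
  step a@(suc _) ih with q ∣? a
  ... | no q∤a = subst ((q ∸ 1) ∣_) (sym (φ-*-prime pq q∤a)) (m∣m*n (φ a))
  ... | yes q∣a@(divides b@(suc _) a≡b*q) =
    subst ((q ∸ 1) ∣_) (sym φqa≡) (∣n⇒∣m*n q (ih b<a))
    where
    φqa≡ : φ (q * a) ≡ q * φ (q * b)
    φqa≡ = trans (φ-*-divisor q a q∣a) (cong (λ n → q * φ n) (trans a≡b*q (*-comm b q)))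
    b<a : b < a
    b<a = subst (b <_) (sym a≡b*q) (m<m*n b q (prime⇒2≤ pq))

pred∣φ : ∀ {q m} → Prime q → q ∣ m → (q ∸ 1) ∣ φ m
pred∣φ {q} pq (divides a m≡a*q) =
  subst (λ n → (q ∸ 1) ∣ φ n) (sym (trans m≡a*q (*-comm a q))) (pred∣φ-multiple pq a)

odd-prime-∣⇒φ-even : ∀ {q m} → Prime q → q ≢ 2 → q ∣ m → 2 ∣ φ m
odd-prime-∣⇒φ-even pq q≢2 q∣m = ∣-trans (odd-prime-pred-even pq q≢2) (pred∣φ pq q∣m)

-- φ (2·b) is even for b ≥ 2: either 2 ∣ b and φ (2·b) = 2·φ b, or b has
-- an odd prime divisor.
φ-double-even : ∀ b → 2 ≤ b → 2 ∣ φ (2 * b)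
φ-double-even b 2≤b with 2 ∣? b
... | yes 2∣b = subst (2 ∣_) (sym (φ-*-divisor 2 b 2∣b)) (m∣m*n (φ b))
... | no 2∤b with prime-divisor b 2≤b
...   | r , pr , r∣b = odd-prime-∣⇒φ-even pr (λ { refl → 2∤b r∣b }) (∣n⇒∣m*n 2 r∣b)

half-≥2 : ∀ b → 3 ≤ b * 2 → 2 ≤ b
half-≥2 (suc zero) (s≤s (s≤s ()))
half-≥2 (suc (suc b)) _ = s≤s (s≤s z≤n)

φ-even : ∀ m → 3 ≤ m → 2 ∣ φ m
φ-even m 3≤m with prime-divisor m (≤-trans (n≤1+n 2) 3≤m)
... | q , pq , q∣m with q ≟ 2
...   | no q≢2 = odd-prime-∣⇒φ-even pq q≢2 q∣m
...   | yes refl with q∣m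
...     | divides b m≡b*2 =
  subst (λ n → 2 ∣ φ n) (sym (trans m≡b*2 (*-comm b 2)))
        (φ-double-even b (half-≥2 b (subst (3 ≤_) m≡b*2 3≤m)))

φ-odd : ∀ m → ¬ 2 ∣ φ m → φ m ≡ 1
φ-odd zero          φ0-odd = contradiction (2 ∣0) φ0-odd
φ-odd (suc zero)    _      = refl
φ-odd (suc (suc zero)) _   = refl
φ-odd m@(suc (suc (suc _))) φm-odd = contradiction (φ-even m (s≤s (s≤s (s≤s z≤n)))) φm-odd

ExceptionalDivisor : ℕ → Set
ExceptionalDivisor y = ∃[ q ] (Prime q × q ∣ y × (q ∸ 1) ∣ 2 * y)

-- The possible reasons for 2y to be a value of φ (y odd, y ≠ 1).
TwiceOddWitness : ℕ → Set
TwiceOddWitness y = Prime (2 * y + 1) ⊎ ExceptionalDivisor y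

-- By strong induction on n: write n = m·q with q
-- prime.  If q ∣ m then q = 2 would give φ m = y odd, hence y = 1, while an
-- odd q divides q·φ m = 2y.  If q ∤ m then q = 2 gives φ m = φ n with m < n,
-- and an odd q gives (q − 1)·φ m = 2y, where φ m even would make y even;
-- so φ m = 1 and q = 2y + 1.
twice-odd-value : ∀ {y} → ¬ 2 ∣ y → y ≢ 1 → ∀ n → φ n ≡ 2 * y → TwiceOddWitness y
twice-odd-value {y} y-odd y≢1 = <-rec (λ n → φ n ≡ 2 * y → TwiceOddWitness y) step
  where
  step : ∀ n → (∀ {m} → m < n → φ m ≡ 2 * y → TwiceOddWitness y) →
         φ n ≡ 2 * y → TwiceOddWitness y
  step zero _ 0≡2y =
    contradiction (subst (2 ∣_) (sym (*-cancelˡ-≡ y 0 2 (sym 0≡2y))) (2 ∣0)) y-odd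
  step (suc zero) _ 1≡2y = contradiction (sym 1≡2y) (even≢odd y 0)
  step n@(suc (suc _)) ih φn≡2y with prime-divisor n (s≤s (s≤s z≤n))
  ... | q , pq , divides zero ()
  ... | q , pq , q∣n@(divides m@(suc _) n≡m*q) = cases (q ∣? m) (q ≟ 2)
    where
    φqm≡2y : φ (q * m) ≡ 2 * y
    φqm≡2y = trans (cong φ (trans (*-comm q m) (sym n≡m*q))) φn≡2y
    m<n : m < n
    m<n = subst (m <_) (sym n≡m*q) (m<m*n m q (prime⇒2≤ pq))
    cases : Dec (q ∣ m) → Dec (q ≡ 2) → TwiceOddWitness y
    cases (yes q∣m) (yes refl) = contradiction (trans (sym φm≡y) φm≡1) y≢1
      where
      φm≡y : φ m ≡ y
      φm≡y = *-cancelˡ-≡ (φ m) y 2 (trans (sym (φ-*-divisor 2 m q∣m)) φqm≡2y)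
      φm≡1 : φ m ≡ 1
      φm≡1 = φ-odd m (subst (λ z → ¬ 2 ∣ z) (sym φm≡y) y-odd)
    cases (yes q∣m) (no q≢2) =
      inj₂ (q , pq , odd-prime-∣-double pq q≢2 q∣2y , subst ((q ∸ 1) ∣_) φn≡2y (pred∣φ pq q∣n))
      where
      q∣2y : q ∣ 2 * y
      q∣2y = subst (q ∣_) (trans (sym (φ-*-divisor q m q∣m)) φqm≡2y) (m∣m*n (φ m))
    cases (no q∤m) (yes refl) =
      ih m<n (trans (sym (*-identityˡ (φ m))) (trans (sym (φ-*-prime pq q∤m)) φqm≡2y))
    cases (no q∤m) (no q≢2) with 2 ∣? φ m
    ... | yes 2∣φm = contradiction (even-product (odd-prime-pred-even pq q≢2) 2∣φm pred*φm≡2y) y-odd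
      where
      pred*φm≡2y : (q ∸ 1) * φ m ≡ 2 * y
      pred*φm≡2y = trans (sym (φ-*-prime pq q∤m)) φqm≡2y
    ... | no φm-odd = inj₁ (subst Prime (sym 2y+1≡q) pq)
      where
      pred≡2y : q ∸ 1 ≡ 2 * y
      pred≡2y = begin
        q ∸ 1             ≡⟨ sym (*-identityʳ (q ∸ 1)) ⟩
        (q ∸ 1) * 1       ≡⟨ cong ((q ∸ 1) *_) (sym (φ-odd m φm-odd)) ⟩
        (q ∸ 1) * φ m     ≡⟨ sym (φ-*-prime pq q∤m) ⟩
        φ (q * m)         ≡⟨ φqm≡2y ⟩
        2 * y             ∎
        where open ≡-Reasoning
      2y+1≡q : 2 * y + 1 ≡ q
      2y+1≡q = trans (cong (_+ 1) (sym pred≡2y)) (m∸n+n≡m (≤-trans (n≤1+n 1) (prime⇒2≤ pq)))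

twice-odd+1-mod4 : ∀ {y} → ¬ 2 ∣ y → (2 * y + 1) % 4 ≡ 3
twice-odd+1-mod4 {y} y-odd with parity y
... | inj₁ 2∣y = contradiction 2∣y y-odd
... | inj₂ (t , y≡1+2t) = begin
  (2 * y + 1) % 4               ≡⟨ cong (λ z → (2 * z + 1) % 4) y≡1+2t ⟩
  (2 * (1 + t * 2) + 1) % 4     ≡⟨ cong (_% 4) (expand t) ⟩
  (3 + t * 4) % 4               ≡⟨ [m+kn]%n≡m%n 3 t 4 ⟩
  3                             ∎
  where
  open ≡-Reasoning
  expand : ∀ t → 2 * (1 + t * 2) + 1 ≡ 3 + t * 4
  expand = solve-∀

square-mod3 : ∀ a → ¬ 3 ∣ a → (a * a) % 3 ≡ 1
square-mod3 a 3∤a with a % 3 | m%n<n a 3 | %-distribˡ-* a a 3 | m≡m%n+[m/n]*n a 3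
... | 0 | _ | _   | a≡[a/3]*3 = contradiction (divides (a / 3) a≡[a/3]*3) 3∤a
... | 1 | _ | a²% | _ = a²%
... | 2 | _ | a²% | _ = a²%
... | suc (suc (suc _)) | s≤s (s≤s (s≤s ())) | _ | _

power-mod-≡1 : ∀ d′ x t → x % suc (suc d′) ≡ 1 → (x ^ t) % suc (suc d′) ≡ 1
power-mod-≡1 d′ x zero    _ = refl
power-mod-≡1 d′ x (suc t) x≡1 =
  trans (%-distribˡ-* x (x ^ t) (suc (suc d′)))
        (cong₂ (λ a b → (a * b) % suc (suc d′)) x≡1 (power-mod-≡1 d′ x t x≡1))

-- If 3 ∤ a then a^(2t) ≡ 1 (mod 3), so 3 ∣ 2·a^(2t) + 1.
three-∣-double-even-power+1 : ∀ a t → ¬ 3 ∣ a → 3 ∣ 2 * a ^ (t * 2) + 1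
three-∣-double-even-power+1 a t 3∤a = m%n≡0⇒n∣m _ 3 (begin
  (2 * z + 1) % 3              ≡⟨ %-distribˡ-+ (2 * z) 1 3 ⟩
  ((2 * z) % 3 + 1) % 3        ≡⟨ cong (λ w → (w + 1) % 3) (%-distribˡ-* 2 z 3) ⟩
  ((2 * (z % 3)) % 3 + 1) % 3  ≡⟨ cong (λ w → ((2 * w) % 3 + 1) % 3) z≡1 ⟩
  0                            ∎)
  where
  open ≡-Reasoning
  z : ℕ
  z = a ^ (t * 2)
  z≡[a²]ᵗ : z ≡ (a * a) ^ t
  z≡[a²]ᵗ = begin
    a ^ (t * 2)    ≡⟨ cong (a ^_) (*-comm t 2) ⟩
    a ^ (2 * t)    ≡⟨ sym (^-*-assoc a 2 t) ⟩
    (a ^ 2) ^ t    ≡⟨ cong (λ b → (a * b) ^ t) (*-identityʳ a) ⟩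
    (a * a) ^ t    ∎
  z≡1 : z % 3 ≡ 1
  z≡1 = trans (cong (_% 3) z≡[a²]ᵗ) (power-mod-≡1 1 (a * a) t (square-mod3 a 3∤a))

coprime-power : ∀ {a b} k → Coprime a b → Coprime a (b ^ k)
coprime-power zero    _   (_ , d∣1) = ∣1⇒≡1 d∣1
coprime-power (suc k) a⊥b = coprime-* a⊥b (coprime-power k a⊥b)

power≢1 : ∀ {p k} → Prime p → 1 ≤ k → p ^ k ≢ 1
power≢1 {p} {k} pp 1≤k pᵏ≡1 with m^n≡1⇒n≡0∨m≡1 p k pᵏ≡1
... | inj₁ refl = contradiction 1≤k λ ()
... | inj₂ p≡1  = prime≢1 pp p≡1

-- For an odd prime p ≠ 3 we have p ≥ 5, so p − 1 does not divide 2.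
pred∤2 : ∀ {p} → Prime p → ¬ 2 ∣ p → p ≢ 3 → ¬ (p ∸ 1) ∣ 2
pred∤2 {suc (suc zero)} _ p-odd _ _ = p-odd (divides 1 refl)
pred∤2 {suc (suc (suc zero))} _ _ p≢3 _ = p≢3 refl
pred∤2 {suc (suc (suc (suc _)))} _ _ _ pred∣2 with ∣⇒≤ pred∣2
... | s≤s (s≤s ())

-- For an odd prime p ≠ 3, pᵏ has no exceptional divisor: such a divisor q
-- would be p, and then (p − 1) ∣ 2 since p − 1 is coprime to pᵏ.
no-prime-power-witness : ∀ {p k} → Prime p → ¬ 2 ∣ p → p ≢ 3 →
  ¬ ExceptionalDivisor (p ^ k)
no-prime-power-witness {p@(suc p′)} {k} pp p-odd p≢3 (q , pq , q∣pᵏ , pred∣2pᵏ)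
  with divisor-of-prime pp (prime-∣-power p k pq q∣pᵏ) (prime≢1 pq)
... | refl = pred∤2 pp p-odd p≢3
  (coprime-divisor (coprime-power k (coprime-consecutive p′))
                   (subst (p′ ∣_) (*-comm 2 (p ^ k)) pred∣2pᵏ))

-- If 2pᵏ + 1 is prime (p prime, p ≠ 3, k ≥ 1) then k is odd: otherwise
-- 3 ∣ 2pᵏ + 1, forcing 2pᵏ + 1 = 3 and pᵏ = 1.
exponent-odd : ∀ {p k} → Prime p → p ≢ 3 → 1 ≤ k → Prime (2 * p ^ k + 1) → k % 2 ≡ 1
exponent-odd {p} {k} pp p≢3 1≤k N+1-prime with parity k
... | inj₂ (t , k≡1+2t) = trans (cong (_% 2) k≡1+2t) ([m+kn]%n≡m%n 1 t 2)
... | inj₁ (divides t k≡2t) = contradiction pᵏ≡1 (power≢1 pp 1≤k)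
  where
  3∤p : ¬ 3 ∣ p
  3∤p 3∣p = p≢3 (sym (divisor-of-prime pp 3∣p (λ ())))
  3∣N+1 : 3 ∣ 2 * p ^ k + 1
  3∣N+1 = subst (λ j → 3 ∣ 2 * p ^ j + 1) (sym k≡2t) (three-∣-double-even-power+1 p t 3∤p)
  pᵏ≡1 : p ^ k ≡ 1
  pᵏ≡1 = *-cancelˡ-≡ (p ^ k) 1 2
           (+-cancelʳ-≡ 1 (2 * p ^ k) 2 (sym (divisor-of-prime N+1-prime 3∣N+1 (λ ()))))

mainTheorem12 : (p k : ℕ) → Prime p → p % 2 ≡ 1 → p ≢ 3 → 1 ≤ k →
    (InImageφ (2 * p ^ k) ⇔
      (Prime (2 * p ^ k + 1) × ((2 * p ^ k + 1) % 4 ≡ 3) × (k % 2 ≡ 1)))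
mainTheorem12 p k pp p%2≡1 p≢3 1≤k = mk⇔ forward backward
  where
  p-odd : ¬ 2 ∣ p
  p-odd 2∣p = 0≢1+n (trans (sym (n∣m⇒m%n≡0 p 2 2∣p)) p%2≡1)
  pᵏ-odd : ¬ 2 ∣ p ^ k
  pᵏ-odd = p-odd ∘ prime-∣-power p k prime[2]
  forward : InImageφ (2 * p ^ k) →
    Prime (2 * p ^ k + 1) × ((2 * p ^ k + 1) % 4 ≡ 3) × (k % 2 ≡ 1)
  forward (n , φ≡) with twice-odd-value pᵏ-odd (power≢1 pp 1≤k) (suc n) φ≡
  ... | inj₁ N+1-prime = N+1-prime , twice-odd+1-mod4 pᵏ-odd , exponent-odd pp p≢3 1≤k N+1-prime
  ... | inj₂ witness   = contradiction witness (no-prime-power-witness {k = k} pp p-odd p≢3)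
  backward : Prime (2 * p ^ k + 1) × ((2 * p ^ k + 1) % 4 ≡ 3) × (k % 2 ≡ 1) →
    InImageφ (2 * p ^ k)
  backward (N+1-prime , _ , _) =
    2 * p ^ k , φ-prime (subst Prime (+-comm (2 * p ^ k) 1) N+1-prime)
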